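{- $K_6$ is not $2$-list-Ramsey with respect to any family $\mathcal{F}$ of graphs with $m_2(\mathcal{F}) \ge 5/2$.
   Context: $m_2(F) = \max\left(\left\{ \frac{e_{F'}-1}{v_{F'}-2} : \emptyset \ne F' \subseteq F,\ v_{F'} \ge 3 \right\} \cup \{1/2\}\right)$, $m_2(\mathcal{F}) = \min_{F\in\mathcal{F}} m_2(F)$. A graph is $2$-list-Ramsey for $\mathcal{F}$ if there is an assignment of lists of $2$ colours to its edges such that every colouring from the lists contains a monochromatic copy of some member of $\mathcal{F}$. -}

module Defs where

open import Data.Nat as ℕ using (ℕ; zero; suc; _<_; _<ᵇ_)
open import Data.Fin using (Fin; toℕ; _≟_)
open import Data.Bool using (Bool; true; false; not; _∧_; if_then_else_)
open import Data.List using (List; map; allFin)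
open import Data.Nat.ListAction using (sum)
open import Data.Product using (Σ; _×_; _,_; proj₁; proj₂)
open import Data.Sum using (_⊎_)
open import Data.Integer as ℤ using (+_)
open import Data.Rational using (ℚ; _/_; ½; _≤_)
open import Relation.Nullary using (¬_; does; yes; no)
open import Relation.Binary.PropositionalEquality using (_≡_; _≢_; refl; sym)
open import Function.Definitions using (Injective)

record Graph : Set where
  field
    n      : ℕ
    adj    : Fin n → Fin n → Bool
    adjSym : ∀ u v → adj u v ≡ adj v u
    irrefl : ∀ u → adj u u ≡ false
open Graph public

private
  neqSym : ∀ {m} (i j : Fin m) → not (does (i ≟ j)) ≡ not (does (j ≟ i))
  neqSym i j with i ≟ j | j ≟ i
  ... | yes _ | yes _ = refl
  ... | no _  | no _  = refl
  ... | yes p | no q  = Data.Empty.⊥-elim (q (sym p))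
    where import Data.Empty
  ... | no p  | yes q = Data.Empty.⊥-elim (p (sym q))
    where import Data.Empty

  neqIrr : ∀ {m} (i : Fin m) → not (does (i ≟ i)) ≡ false
  neqIrr i with i ≟ i
  ... | yes _ = refl
  ... | no p  = Data.Empty.⊥-elim (p refl)
    where import Data.Empty

K : ℕ → Graph
K m = record { n = m ; adj = λ i j → not (does (i ≟ j)) ; adjSym = neqSym ; irrefl = neqIrr }

edgeCount : Graph → ℕ
edgeCount G = sum (map (λ i → sum (map (λ j → if adj G i j ∧ (toℕ i <ᵇ toℕ j) then 1 else 0)
                                        (allFin (n G))))
                       (allFin (n G)))

record SubgraphOf (G : Graph) : Set where
  field
    H    : Graph
    emb  : Fin (n H) → Fin (n G)
    inj  : Injective _≡_ _≡_ emb
    pres : ∀ u v → adj H u v ≡ true → adj G (emb u) (emb v) ≡ true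
open SubgraphOf public

-- Elements of the set whose maximum is m_2(G):
-- 1/2, and (e_{F'} - 1)/(v_{F'} - 2) for subgraphs F' with v_{F'} = 3 + k ≥ 3.
M2Candidate : Graph → ℚ → Set
M2Candidate G q =
  (q ≡ ½) ⊎
  Σ (SubgraphOf G) λ S → Σ ℕ λ k →
    (n (H S) ≡ 3 ℕ.+ k) × (q ≡ ((+ edgeCount (H S)) ℤ.- (+ 1)) / suc k)

IsM2 : Graph → ℚ → Set
IsM2 G q = M2Candidate G q × (∀ r → M2Candidate G r → r ≤ q)

Family : Set₁
Family = Graph → Set

-- m_2(𝓕) ≥ 5/2 : the minimum over members is ≥ 5/2, i.e. every member has m_2 ≥ 5/2.
M2FamilyAtLeast : Family → ℚ → Set
M2FamilyAtLeast 𝓕 t = ∀ F → 𝓕 F → Σ ℚ λ q → IsM2 F q × (t ≤ q)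

Edge : (G : Graph) → Fin (n G) → Fin (n G) → Set
Edge G i j = (adj G i j ≡ true) × (toℕ i < toℕ j)

ListAssignment : Graph → Set
ListAssignment G = Fin (n G) → Fin (n G) → ℕ × ℕ

Valid2Lists : (G : Graph) → ListAssignment G → Set
Valid2Lists G L = ∀ i j → Edge G i j → proj₁ (L i j) ≢ proj₂ (L i j)

Colouring : Graph → Set
Colouring G = Fin (n G) → Fin (n G) → ℕ

FromLists : (G : Graph) → ListAssignment G → Colouring G → Set
FromLists G L col = ∀ i j → Edge G i j → (col i j ≡ proj₁ (L i j)) ⊎ (col i j ≡ proj₂ (L i j))

HasMonoCopy : (G : Graph) → Family → Colouring G → Set
HasMonoCopy G 𝓕 col =
  Σ Graph λ F → 𝓕 F × Σ ℕ λ c → Σ (Fin (n F) → Fin (n G)) λ φ →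
    Injective _≡_ _≡_ φ ×
    (∀ u v → adj F u v ≡ true → toℕ (φ u) < toℕ (φ v) →
       (adj G (φ u) (φ v) ≡ true) × (col (φ u) (φ v) ≡ c))

Is2ListRamsey : Graph → Family → Set
Is2ListRamsey G 𝓕 =
  Σ (ListAssignment G) λ L → Valid2Lists G L ×
    (∀ col → FromLists G L col → HasMonoCopy G 𝓕 col)

module Submission where

-- Given lists of two colours on the edges of K₆, we colour from the lists so that no colour class
-- contains a K₄ and every colour class has at most 10 edges. A monochromatic graph on v = 3, 4, 5, 6
-- vertices then has at most 3, 5, 8, 10 edges (a K₄-free graph on four vertices misses an edge, on five
-- vertices two), so (e − 1)/(v − 2) < 5/2 for it, whereas every graph of m₂ ≥ 5/2 has a subgraph with
-- (e − 1)/(v − 2) ≥ 5/2.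
--
-- The colouring: split the vertices into three pairs by a perfect matching, give pair i a colour M i from
-- the list of its edge, and let the pairs form a cyclic tournament. An edge inside pair i gets M i; an edge
-- between two pairs gets an entry of its list other than both pair colours if there is one, and otherwise
-- (its list consists of the two pair colours) the colour of the winning pair. In a monochromatic K₄ two
-- vertices share a pair, which then beats the pairs of both other vertices, impossible in a cyclic
-- tournament. The colour M i avoids the inner edge of a pair of another colour and the four edges between
-- pair i and the pair beating it, so it has at most 10 edges. Any other colour is used at most as often as
-- it is listed; the 15 lists have 30 entries, so at most two colours are listed more than 10 times, and
-- counting along a one-factorisation of K₆ gives a perfect matching on which both can be pair colours.

open import Defs
import Data.Nat.Properties as ℕ
open import Algebra.Properties.CommutativeMonoid.Sum ℕ.+-0-commutativeMonoid
  using (sum; sum-syntax; sum-remove; sum-cong-≗; sum-replicate-zero; ∑-distrib-+; ∑-comm; ∑-permute)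
open import Data.Bool as Bool using (Bool; true; false; if_then_else_; not; _∧_; T)
open import Data.Bool.Properties using (¬-not)
open import Data.Empty using (⊥; ⊥-elim)
open import Data.Fin as Fin using (Fin; toℕ; zero; suc; punchIn; punchOut; _≟_)
open import Data.Fin.Patterns using (0F; 1F; 2F; 3F; 4F; 5F)
open import Data.Fin.Permutation using (Permutation; permutation; _⟨$⟩ʳ_; _⟨$⟩ˡ_; inverseʳ)
open import Data.Fin.Properties using (any?; all?; toℕ-injective; suc-injective; injective⇒≤; pigeonhole; <⇒≢;
  punchInᵢ≢i; punchIn-injective; punchOut-injective; punchIn-punchOut; remQuot-combine; combine-remQuot)
open import Data.Integer as ℤ using (ℤ; +_)
open import Data.Integer.GCD using (gcd)
import Data.Integer.Properties as ℤ
open import Data.Integer.Tactic.RingSolver using (solve-∀)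
open import Data.List using (map; allFin; tabulate)
open import Data.List.Properties using (map-tabulate)
open import Data.Nat as ℕ using (ℕ; zero; suc; _+_; _*_; _≤_; _<_; _<ᵇ_; z≤n; s≤s)
open import Data.Nat.ListAction using () renaming (sum to sumₗ)
import Data.Nat.Tactic.RingSolver as ℕ-Solver
open import Data.Product using (Σ; ∃; ∃₂; _×_; _,_; proj₁; proj₂)
open import Data.Rational as ℚ using (ℚ; _/_; ½; ↥_; ↧_; *≤*)
open import Data.Rational.Properties as ℚ using (↥-/; ↧-/)
open import Data.Sum as Sum using (_⊎_; inj₁; inj₂; [_,_]′)
open import Data.Unit using (tt)
open import Data.Vec as Vec using (Vec; []; _∷_)
open import Function using (_∘_; flip)
open import Function.Definitions using (Injective; Surjective)
open import Relation.Binary using (tri<; tri≈; tri>)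
open import Relation.Binary.PropositionalEquality
open import Relation.Nullary using (¬_; ¬?; Dec; yes; no; does)
open import Relation.Nullary.Decidable using (dec-true; dec-false; decidable-stable; from-yes; from-no;
  _×-dec_; _⊎-dec_; _→-dec_)

private variable
  A : Set
  v : ℕ

𝟙 : Bool → ℕ
𝟙 b = if b then 1 else 0

𝟙≤1 : ∀ b → 𝟙 b ≤ 1
𝟙≤1 true  = ℕ.≤-refl
𝟙≤1 false = z≤n

does-true : (d : Dec A) → does d ≡ true → A
does-true (yes a) _ = a

𝟙-sum≤2 : ∀ x y z → ¬ (x ≡ true × y ≡ true × z ≡ true) → 𝟙 x + 𝟙 y + 𝟙 z ≤ 2
𝟙-sum≤2 true  true  true  not-all = ⊥-elim (not-all (refl , refl , refl))
𝟙-sum≤2 true  true  false _       = ℕ.≤-refl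
𝟙-sum≤2 true  false z     _       = s≤s (𝟙≤1 z)
𝟙-sum≤2 false y     z     _       = ℕ.≤-trans (ℕ.+-mono-≤ (𝟙≤1 y) (𝟙≤1 z)) ℕ.≤-refl

-- Counting over the pairs i < j

∑-mono-≤ : {f g : Fin v → ℕ} → (∀ i → f i ≤ g i) → sum f ≤ sum g
∑-mono-≤ {zero}  f≤g = z≤n
∑-mono-≤ {suc v} f≤g = ℕ.+-mono-≤ (f≤g zero) (∑-mono-≤ (f≤g ∘ suc))

term≤∑ : (f : Fin v → ℕ) (i : Fin v) → f i ≤ sum f
term≤∑ {suc v} f i = ℕ.≤-trans (ℕ.m≤m+n (f i) _) (ℕ.≤-reflexive (sym (sum-remove {i = i} f)))

∑-select : (f : Fin v → ℕ) (i : Fin v) → ∑[ j < v ] (if does (i ≟ j) then f j else 0) ≡ f i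
∑-select {suc v} f i = begin
  ∑[ j < suc v ] δ j                            ≡⟨ sum-remove {i = i} δ ⟩
  δ i + ∑[ k < v ] δ (punchIn i k)              ≡⟨ cong₂ _+_ δ-diag (sum-cong-≗ δ-off) ⟩
  f i + ∑[ k < v ] 0                            ≡⟨ cong (f i ℕ.+_) (sum-replicate-zero v) ⟩
  f i + 0                                       ≡⟨ ℕ.+-identityʳ (f i) ⟩
  f i                                           ∎
  where
  open ≡-Reasoning
  δ : Fin (suc v) → ℕ
  δ j = if does (i ≟ j) then f j else 0
  δ-diag : δ i ≡ f i
  δ-diag rewrite dec-true (i ≟ i) refl = refl
  δ-off : ∀ k → δ (punchIn i k) ≡ 0
  δ-off k rewrite dec-false (i ≟ punchIn i k) (punchInᵢ≢i i k ∘ sym) = refl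

sumₗ-allFin : (f : Fin v → ℕ) → sumₗ (map f (allFin v)) ≡ sum f
sumₗ-allFin f = trans (cong sumₗ (map-tabulate (λ i → i) f)) (sumₗ-tabulate f)
  where
  sumₗ-tabulate : ∀ {m} (g : Fin m → ℕ) → sumₗ (tabulate g) ≡ sum g
  sumₗ-tabulate {zero}  g = refl
  sumₗ-tabulate {suc m} g = cong (g zero ℕ.+_) (sumₗ-tabulate (g ∘ suc))

<ᵇ≡true : ∀ {m n} → m < n → (m <ᵇ n) ≡ true
<ᵇ≡true {m} {n} m<n with m <ᵇ n | ℕ.<⇒<ᵇ m<n
... | true | _ = refl

<ᵇ≡false : ∀ {m n} → ¬ m < n → (m <ᵇ n) ≡ false
<ᵇ≡false {m} {n} m≮n with m <ᵇ n in eq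
... | true  = ⊥-elim (m≮n (ℕ.<ᵇ⇒< m n (subst T (sym eq) _)))
... | false = refl

upper : (Fin v → Fin v → ℕ) → Fin v → Fin v → ℕ
upper h i j = if toℕ i <ᵇ toℕ j then h i j else 0

pairSum : (v : ℕ) → (Fin v → Fin v → ℕ) → ℕ
pairSum v h = ∑[ i < v ] ∑[ j < v ] upper h i j

upper-< : (h : Fin v → Fin v → ℕ) {i j : Fin v} → toℕ i < toℕ j → upper h i j ≡ h i j
upper-< h i<j rewrite <ᵇ≡true i<j = refl

upper-≮ : (h : Fin v → Fin v → ℕ) {i j : Fin v} → ¬ toℕ i < toℕ j → upper h i j ≡ 0
upper-≮ h i≮j rewrite <ᵇ≡false i≮j = refl

upper-mono : {h g : Fin v → Fin v → ℕ} → (∀ i j → toℕ i < toℕ j → h i j ≤ g i j) →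
             ∀ i j → upper h i j ≤ upper g i j
upper-mono {h = h} {g} h≤g i j with ℕ.<-cmp (toℕ i) (toℕ j)
... | tri< i<j _ _ = subst₂ _≤_ (sym (upper-< h i<j)) (sym (upper-< g i<j)) (h≤g i j i<j)
... | tri≈ i≮j _ _ = ℕ.≤-reflexive (trans (upper-≮ h i≮j) (sym (upper-≮ g i≮j)))
... | tri> i≮j _ _ = ℕ.≤-reflexive (trans (upper-≮ h i≮j) (sym (upper-≮ g i≮j)))

pairSum-mono : {h g : Fin v → Fin v → ℕ} → (∀ i j → toℕ i < toℕ j → h i j ≤ g i j) →
               pairSum v h ≤ pairSum v g
pairSum-mono h≤g = ∑-mono-≤ λ i → ∑-mono-≤ (upper-mono h≤g i)

pairSum-cong : {h g : Fin v → Fin v → ℕ} → (∀ i j → h i j ≡ g i j) → pairSum v h ≡ pairSum v g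
pairSum-cong h≡g = sum-cong-≗ λ i → sum-cong-≗ λ j → cong (if _ then_else 0) (h≡g i j)

pairSum-+ : (h g : Fin v → Fin v → ℕ) → pairSum v (λ i j → h i j + g i j) ≡ pairSum v h + pairSum v g
pairSum-+ {v} h g = begin
  ∑[ i < v ] ∑[ j < v ] upper (λ i j → h i j + g i j) i j     ≡⟨ sum-cong-≗ (λ i → sum-cong-≗ (upper-+ i)) ⟩
  ∑[ i < v ] ∑[ j < v ] (upper h i j + upper g i j)         ≡⟨ sum-cong-≗ (λ i → ∑-distrib-+ (upper h i) (upper g i)) ⟩
  ∑[ i < v ] (∑[ j < v ] upper h i j + ∑[ j < v ] upper g i j) ≡⟨ ∑-distrib-+ (λ i → ∑[ j < v ] upper h i j) _ ⟩
  pairSum v h + pairSum v g                                 ∎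
  where
  open ≡-Reasoning
  upper-+ : ∀ i j → upper (λ i j → h i j + g i j) i j ≡ upper h i j + upper g i j
  upper-+ i j with toℕ i <ᵇ toℕ j
  ... | true  = refl
  ... | false = refl

entry≤pairSum : (h : Fin v → Fin v → ℕ) {i j : Fin v} → toℕ i < toℕ j → h i j ≤ pairSum v h
entry≤pairSum {v} h {i} {j} i<j = begin
  h i j                        ≡⟨ upper-< h i<j ⟨
  upper h i j                  ≤⟨ term≤∑ (upper h i) j ⟩
  ∑[ j < v ] upper h i j       ≤⟨ term≤∑ (λ i → ∑[ j < v ] upper h i j) i ⟩
  pairSum v h                  ∎
  where open ℕ.≤-Reasoning

∑∑≡pairSum+pairSumᵀ+∑diag : (h : Fin v → Fin v → ℕ) →
  ∑[ i < v ] ∑[ j < v ] h i j ≡ pairSum v h + pairSum v (flip h) + ∑[ i < v ] h i i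
∑∑≡pairSum+pairSumᵀ+∑diag {v} h = begin
  ∑[ i < v ] ∑[ j < v ] h i j
    ≡⟨ sum-cong-≗ (λ i → sum-cong-≗ (split i)) ⟩
  ∑[ i < v ] ∑[ j < v ] (upper h i j + upper (flip h) j i + diag i j)
    ≡⟨ sum-cong-≗ (λ i → trans (∑-distrib-+ (λ j → upper h i j + upper (flip h) j i) (diag i))
                                 (cong (_+ D i) (∑-distrib-+ (upper h i) (λ j → upper (flip h) j i)))) ⟩
  ∑[ i < v ] (R i + C i + D i)
    ≡⟨ trans (∑-distrib-+ (λ i → R i + C i) D) (cong (_+ sum D) (∑-distrib-+ R C)) ⟩
  pairSum v h + sum C + sum D
    ≡⟨ cong₂ (λ a b → pairSum v h + a + b) (∑-comm (λ i j → upper (flip h) j i)) (sum-cong-≗ λ i → ∑-select (h i) i) ⟩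
  pairSum v h + pairSum v (flip h) + ∑[ i < v ] h i i
    ∎
  where
  open ≡-Reasoning
  diag : Fin v → Fin v → ℕ
  diag i j = if does (i ≟ j) then h i j else 0
  R C D : Fin v → ℕ
  R i = ∑[ j < v ] upper h i j
  C i = ∑[ j < v ] upper (flip h) j i
  D i = ∑[ j < v ] diag i j
  split : ∀ i j → h i j ≡ upper h i j + upper (flip h) j i + diag i j
  split i j with ℕ.<-cmp (toℕ i) (toℕ j)
  ... | tri< i<j _ j≮i
    rewrite upper-< h i<j | upper-≮ (flip h) j≮i | dec-false (i ≟ j) (ℕ.<⇒≢ i<j ∘ cong toℕ)
    = sym (trans (ℕ.+-identityʳ _) (ℕ.+-identityʳ _))
  ... | tri> i≮j _ j<i
    rewrite upper-≮ h i≮j | upper-< (flip h) j<i | dec-false (i ≟ j) (ℕ.>⇒≢ j<i ∘ cong toℕ)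
    = sym (ℕ.+-identityʳ _)
  ... | tri≈ i≮j i≡j _ with refl ← toℕ-injective i≡j
    rewrite upper-≮ h i≮j | dec-true (i ≟ i) refl
    = refl

pairSum-permute : (π : Permutation v v) (h : Fin v → Fin v → ℕ) → (∀ i j → h i j ≡ h j i) →
                  pairSum v (λ i j → h (π ⟨$⟩ʳ i) (π ⟨$⟩ʳ j)) ≡ pairSum v h
pairSum-permute {v} π h h-sym = ℕ.*-cancelˡ-≡ _ _ 2 (ℕ.+-cancelʳ-≡ _ _ _ (begin
  2 * pairSum v hπ + ∑[ i < v ] hπ i i       ≡⟨ double hπ (λ i j → h-sym _ _) ⟩
  ∑[ i < v ] ∑[ j < v ] hπ i j                ≡⟨ sum-cong-≗ (λ i → ∑-permute (h (π ⟨$⟩ʳ i)) π) ⟨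
  ∑[ i < v ] ∑[ j < v ] h (π ⟨$⟩ʳ i) j        ≡⟨ ∑-permute (λ i → ∑[ j < v ] h i j) π ⟨
  ∑[ i < v ] ∑[ j < v ] h i j                 ≡⟨ double h h-sym ⟨
  2 * pairSum v h + ∑[ i < v ] h i i          ≡⟨ cong (2 * pairSum v h ℕ.+_) (∑-permute (λ i → h i i) π) ⟩
  2 * pairSum v h + ∑[ i < v ] hπ i i         ∎))
  where
  open ≡-Reasoning
  hπ : Fin v → Fin v → ℕ
  hπ i j = h (π ⟨$⟩ʳ i) (π ⟨$⟩ʳ j)
  double : (g : Fin v → Fin v → ℕ) → (∀ i j → g i j ≡ g j i) →
           2 * pairSum v g + ∑[ i < v ] g i i ≡ ∑[ i < v ] ∑[ j < v ] g i j
  double g g-sym = sym (begin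
    ∑[ i < v ] ∑[ j < v ] g i j
      ≡⟨ ∑∑≡pairSum+pairSumᵀ+∑diag g ⟩
    pairSum v g + pairSum v (flip g) + ∑[ i < v ] g i i
      ≡⟨ cong (λ s → pairSum v g + s + sum dg) (pairSum-cong (λ i j → g-sym j i)) ⟩
    pairSum v g + pairSum v g + ∑[ i < v ] g i i
      ≡⟨ cong (λ s → pairSum v g + s + sum dg) (ℕ.+-identityʳ _) ⟨
    2 * pairSum v g + ∑[ i < v ] g i i
      ∎)
    where
    dg : Fin v → ℕ
    dg i = g i i

injective⇒surjective : {f : Fin v → Fin v} → Injective _≡_ _≡_ f → Surjective _≡_ _≡_ f
injective⇒surjective {suc v} {f} f-inj y with any? (λ x → f x ≟ y)
... | yes (x , fx≡y) = x , λ { refl → fx≡y }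
... | no ∄x = ⊥-elim (ℕ.<-irrefl refl (injective⇒≤ avoid-y-injective))
  where
  fx≢y : ∀ x → f x ≢ y
  fx≢y x fx≡y = ∄x (x , fx≡y)
  avoid-y : Fin (suc v) → Fin v
  avoid-y x = punchOut (fx≢y x ∘ sym)
  avoid-y-injective : Injective _≡_ _≡_ avoid-y
  avoid-y-injective {a} {b} eq = f-inj (punchOut-injective (fx≢y a ∘ sym) (fx≢y b ∘ sym) eq)

injective⇒permutation : (f : Fin v → Fin v) → Injective _≡_ _≡_ f → Permutation v v
injective⇒permutation f f-inj =
  permutation f (proj₁ ∘ surj) (λ y → proj₂ (surj y) refl) (λ x → f-inj (proj₂ (surj (f x)) refl))
  where
  surj : Surjective _≡_ _≡_ f
  surj = injective⇒surjective f-inj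

others : ∀ {v} (i j : Fin (suc (suc v))) → i ≢ j → Fin v → Fin (suc (suc v))
others i j i≢j = punchIn i ∘ punchIn (punchOut i≢j)

others≢ˡ : ∀ {v} {i j : Fin (suc (suc v))} (i≢j : i ≢ j) l → others i j i≢j l ≢ i
others≢ˡ {i = i} i≢j l = punchInᵢ≢i i _

others≢ʳ : ∀ {v} {i j : Fin (suc (suc v))} (i≢j : i ≢ j) l → others i j i≢j l ≢ j
others≢ʳ {i = i} i≢j l eq =
  punchInᵢ≢i (punchOut i≢j) l (punchIn-injective i _ _ (trans eq (sym (punchIn-punchOut i≢j))))

others-injective : ∀ {v} {i j : Fin (suc (suc v))} (i≢j : i ≢ j) → Injective _≡_ _≡_ (others i j i≢j)
others-injective {i = i} i≢j = punchIn-injective (punchOut i≢j) _ _ ∘ punchIn-injective i _ _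

pairSum-≤-relabel : (ψ : Fin v → Fin v) → Injective _≡_ _≡_ ψ →
                    (g h : Fin v → Fin v → ℕ) → (∀ i j → h i j ≡ h j i) →
                    (∀ i j → toℕ i < toℕ j → g i j ≤ h (ψ i) (ψ j)) → pairSum v g ≤ pairSum v h
pairSum-≤-relabel ψ ψ-inj g h h-sym g≤hψ = ℕ.≤-trans (pairSum-mono g≤hψ)
  (ℕ.≤-reflexive (pairSum-permute (injective⇒permutation ψ ψ-inj) h h-sym))

edgeCount≡pairSum : (G : Graph) → edgeCount G ≡ pairSum (n G) (λ i j → 𝟙 (adj G i j))
edgeCount≡pairSum G = trans (sumₗ-allFin rowCount) (sum-cong-≗ λ i → trans (sumₗ-allFin (entry i)) (sum-cong-≗ (row i)))
  where
  entry : Fin (n G) → Fin (n G) → ℕ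
  entry i j = if adj G i j ∧ (toℕ i <ᵇ toℕ j) then 1 else 0
  rowCount : Fin (n G) → ℕ
  rowCount i = sumₗ (map (entry i) (allFin (n G)))
  row : ∀ i j → entry i j ≡ upper (λ i j → 𝟙 (adj G i j)) i j
  row i j with adj G i j | toℕ i <ᵇ toℕ j
  ... | true  | _     = refl
  ... | false | true  = refl
  ... | false | false = refl

-- K₄-free graphs on four and five vertices

K₄-free : (Fin v → Fin v → Bool) → Set
K₄-free {v} a = ∀ (f : Fin 4 → Fin v) → Injective _≡_ _≡_ f → ¬ (∀ i j → i ≢ j → a (f i) (f j) ≡ true)

missing-edge : (a : Fin v → Fin v → Bool) → (∀ x y → a x y ≡ a y x) → K₄-free a →
               (f : Fin 4 → Fin v) → Injective _≡_ _≡_ f →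
               ∃₂ λ i j → toℕ (f i) < toℕ (f j) × a (f i) (f j) ≡ false
missing-edge a a-sym free f f-inj
  with any? (λ i → any? (λ j → (toℕ (f i) ℕ.<? toℕ (f j)) ×-dec (a (f i) (f j) Bool.≟ false)))
... | yes found = found
... | no none = ⊥-elim (free f f-inj clique)
  where
  clique : ∀ i j → i ≢ j → a (f i) (f j) ≡ true
  clique i j i≢j with ℕ.<-cmp (toℕ (f i)) (toℕ (f j))
  ... | tri< fi<fj _ _ = ¬-not λ e → none (i , j , fi<fj , e)
  ... | tri> _ _ fj<fi = trans (a-sym _ _) (¬-not λ e → none (j , i , fj<fi , e))
  ... | tri≈ _ fi≡fj _ = ⊥-elim (i≢j (f-inj (toℕ-injective fi≡fj)))

point : Fin v → Fin v → Fin v → Fin v → ℕ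
point u w i j = 𝟙 (does (i ≟ u) ∧ does (j ≟ w))

pairSum-point : {u w : Fin v} → toℕ u < toℕ w → 1 ≤ pairSum v (point u w)
pairSum-point {v} {u = u} {w} u<w = subst (_≤ pairSum v (point u w)) on-diagonal (entry≤pairSum (point u w) u<w)
  where
  on-diagonal : point u w u w ≡ 1
  on-diagonal rewrite dec-true (u ≟ u) refl | dec-true (w ≟ w) refl = refl

edges+non-edges≤ : (a : Fin v → Fin v → Bool) (m : Fin v → Fin v → ℕ) → (∀ i j → 𝟙 (a i j) + m i j ≤ 1) →
                   pairSum v (λ i j → 𝟙 (a i j)) + pairSum v m ≤ pairSum v (λ _ _ → 1)
edges+non-edges≤ a m bound =
  subst (_≤ _) (pairSum-+ (λ i j → 𝟙 (a i j)) m) (pairSum-mono λ i j _ → bound i j)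

edge+point≤1 : (a : Fin v → Fin v → Bool) {u w : Fin v} → a u w ≡ false → ∀ i j → 𝟙 (a i j) + point u w i j ≤ 1
edge+point≤1 a {u} {w} a≡false i j with i ≟ u | j ≟ w
... | yes refl | yes refl rewrite a≡false = ℕ.≤-refl
... | yes _    | no _     = subst (_≤ 1) (sym (ℕ.+-identityʳ _)) (𝟙≤1 _)
... | no _     | _        = subst (_≤ 1) (sym (ℕ.+-identityʳ _)) (𝟙≤1 _)

K₄-free⇒≤5 : (a : Fin 4 → Fin 4 → Bool) → (∀ x y → a x y ≡ a y x) → K₄-free a →
             pairSum 4 (λ i j → 𝟙 (a i j)) ≤ 5
K₄-free⇒≤5 a a-sym free with missing-edge a a-sym free (λ i → i) (λ eq → eq)
... | u , w , u<w , a≡false = ℕ.+-cancelʳ-≤ 1 _ 5 (ℕ.≤-trans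
  (ℕ.+-monoʳ-≤ (pairSum 4 (λ i j → 𝟙 (a i j))) (pairSum-point u<w))
  (edges+non-edges≤ a (point u w) (edge+point≤1 a a≡false)))

K₄-free⇒≤8 : (a : Fin 5 → Fin 5 → Bool) → (∀ x y → a x y ≡ a y x) → K₄-free a →
             pairSum 5 (λ i j → 𝟙 (a i j)) ≤ 8
K₄-free⇒≤8 a a-sym free with missing-edge a a-sym free suc suc-injective
... | i , j , i<j , a≡false with missing-edge a a-sym free (punchIn (suc i)) (punchIn-injective (suc i) _ _)
...   | i′ , j′ , i′<j′ , a′≡false = ℕ.+-cancelʳ-≤ 2 _ 8 (ℕ.≤-trans
  (ℕ.+-monoʳ-≤ (pairSum 5 (λ i j → 𝟙 (a i j)))
    (subst (2 ≤_) (sym (pairSum-+ (point u w) (point u′ w′))) (ℕ.+-mono-≤ (pairSum-point i<j) (pairSum-point i′<j′))))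
  (edges+non-edges≤ a (λ x y → point u w x y + point u′ w′ x y) two-points))
  where
  u w u′ w′ : Fin 5
  u = suc i
  w = suc j
  u′ = punchIn u i′
  w′ = punchIn u j′
  two-points : ∀ x y → 𝟙 (a x y) + (point u w x y + point u′ w′ x y) ≤ 1
  two-points x y with x ≟ u | y ≟ w
  ... | yes refl | yes refl rewrite a≡false | dec-false (u ≟ u′) (punchInᵢ≢i u i′ ∘ sym) = ℕ.≤-refl
  ... | yes _    | no _     = edge+point≤1 a a′≡false x y
  ... | no _     | _        = edge+point≤1 a a′≡false x y

-- Colourings of K₆ without dense monochromatic subgraphs

≤-/⇒*≤* : ∀ {p : ℚ} (i : ℤ) (v : ℕ) .{{_ : ℕ.NonZero v}} → p ℚ.≤ i / v → ↥ p ℤ.* + v ℤ.≤ i ℤ.* ↧ p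
≤-/⇒*≤* {p} i v (*≤* le) = begin
  ↥ p ℤ.* + v            ≡⟨ cong (↥ p ℤ.*_) (↧-/ i v) ⟨
  ↥ p ℤ.* (↧ q ℤ.* g)    ≡⟨ ℤ.*-assoc (↥ p) (↧ q) g ⟨
  ↥ p ℤ.* ↧ q ℤ.* g      ≤⟨ ℤ.*-monoʳ-≤-nonNeg g le ⟩
  ↥ q ℤ.* ↧ p ℤ.* g      ≡⟨ swap (↥ q) (↧ p) g ⟩
  ↥ q ℤ.* g ℤ.* ↧ p      ≡⟨ cong (ℤ._* ↧ p) (↥-/ i v) ⟩
  i ℤ.* ↧ p              ∎
  where
  open ℤ.≤-Reasoning
  q : ℚ
  q = i / v
  g : ℤ
  g = gcd i (+ v)
  swap : ∀ a b c → a ℤ.* b ℤ.* c ≡ a ℤ.* c ℤ.* b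
  swap = solve-∀

five-halves-≤⇒ : ∀ e k → (+ 5) / 2 ℚ.≤ ((+ e) ℤ.- (+ 1)) / suc k → 5 * suc k + 2 ≤ 2 * e
five-halves-≤⇒ e k le = ℤ.drop‿+≤+ (begin
  + (5 * suc k + 2)              ≡⟨ trans (ℤ.pos-+ (5 * suc k) 2) (cong (ℤ._+ + 2) (ℤ.pos-* 5 (suc k))) ⟩
  + 5 ℤ.* + suc k ℤ.+ + 2        ≤⟨ ℤ.+-monoˡ-≤ (+ 2) (≤-/⇒*≤* (+ e ℤ.- + 1) (suc k) le) ⟩
  (+ e ℤ.- + 1) ℤ.* + 2 ℤ.+ + 2  ≡⟨ cancel (+ e) ⟩
  + 2 ℤ.* + e                    ≡⟨ ℤ.pos-* 2 e ⟨
  + (2 * e)                      ∎)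
  where
  open ℤ.≤-Reasoning
  cancel : ∀ x → (x ℤ.- + 1) ℤ.* + 2 ℤ.+ + 2 ≡ + 2 ℤ.* x
  cancel = solve-∀

colourClass : (Fin 6 → Fin 6 → ℕ) → ℕ → Fin 6 → Fin 6 → ℕ
colourClass κ c x y = 𝟙 (does (κ x y ℕ.≟ c))

colourClass-sym : {κ : Fin 6 → Fin 6 → ℕ} → (∀ x y → κ x y ≡ κ y x) →
                  ∀ c x y → colourClass κ c x y ≡ colourClass κ c y x
colourClass-sym κ-sym c x y = cong (λ z → 𝟙 (does (z ℕ.≟ c))) (κ-sym x y)

record GoodColouring (κ : Fin 6 → Fin 6 → ℕ) : Set where
  field
    symmetric           : ∀ x y → κ x y ≡ κ y x
    no-monochromatic-K₄ : ∀ c (f : Fin 4 → Fin 6) → Injective _≡_ _≡_ f → ¬ (∀ i j → i ≢ j → κ (f i) (f j) ≡ c)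
    colourClass≤10      : ∀ c → pairSum 6 (colourClass κ c) ≤ 10

Monochromatic : (Fin 6 → Fin 6 → ℕ) → (Fin v → Fin v → Bool) → (Fin v → Fin 6) → ℕ → Set
Monochromatic κ a ψ c = ∀ u w → a u w ≡ true → κ (ψ u) (ψ w) ≡ c

monochromatic⇒K₄-free : {κ : Fin 6 → Fin 6 → ℕ} → GoodColouring κ → (a : Fin v → Fin v → Bool) →
                        (ψ : Fin v → Fin 6) → Injective _≡_ _≡_ ψ → ∀ c → Monochromatic κ a ψ c → K₄-free a
monochromatic⇒K₄-free good a ψ ψ-inj c mono f f-inj clique =
  GoodColouring.no-monochromatic-K₄ good c (ψ ∘ f) (f-inj ∘ ψ-inj) λ i j i≢j → mono _ _ (clique i j i≢j)

twice-≤-< : ∀ {e b m} → e ≤ b → 2 * b < m → 2 * e < m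
twice-≤-< e≤b 2b<m = ℕ.≤-<-trans (ℕ.*-monoʳ-≤ 2 e≤b) 2b<m

monochromatic-sparse : {κ : Fin 6 → Fin 6 → ℕ} → GoodColouring κ → (k : ℕ) (a : Fin (3 + k) → Fin (3 + k) → Bool) →
                       (∀ x y → a x y ≡ a y x) → (ψ : Fin (3 + k) → Fin 6) → Injective _≡_ _≡_ ψ →
                       ∀ c → Monochromatic κ a ψ c → 2 * pairSum (3 + k) (λ i j → 𝟙 (a i j)) < 5 * suc k + 2
monochromatic-sparse good 0 a a-sym ψ ψ-inj c mono =
  twice-≤-< (pairSum-mono {g = λ _ _ → 1} λ i j _ → 𝟙≤1 (a i j)) (from-yes (6 ℕ.<? 7))
monochromatic-sparse good 1 a a-sym ψ ψ-inj c mono =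
  twice-≤-< (K₄-free⇒≤5 a a-sym (monochromatic⇒K₄-free good a ψ ψ-inj c mono)) (from-yes (10 ℕ.<? 12))
monochromatic-sparse good 2 a a-sym ψ ψ-inj c mono =
  twice-≤-< (K₄-free⇒≤8 a a-sym (monochromatic⇒K₄-free good a ψ ψ-inj c mono)) (from-yes (16 ℕ.<? 17))
monochromatic-sparse {κ} good 3 a a-sym ψ ψ-inj c mono =
  twice-≤-< (ℕ.≤-trans (pairSum-≤-relabel ψ ψ-inj _ (colourClass κ c) (colourClass-sym symmetric c) in-class)
                       (colourClass≤10 c))
          (from-yes (20 ℕ.<? 22))
  where
  open GoodColouring good
  in-class : ∀ i j → toℕ i < toℕ j → 𝟙 (a i j) ≤ colourClass κ c (ψ i) (ψ j)
  in-class i j _ with a i j in aij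
  ... | false = z≤n
  ... | true rewrite dec-true (κ (ψ i) (ψ j) ℕ.≟ c) (mono i j aij) = ℕ.≤-refl
monochromatic-sparse good (suc (suc (suc (suc k)))) a a-sym ψ ψ-inj c mono =
  ⊥-elim (ℕ.≤⇒≯ (injective⇒≤ ψ-inj) (s≤s (ℕ.m≤m+n 6 k)))

relabel-good : {κ : Fin 6 → Fin 6 → ℕ} → GoodColouring κ → (ρ : Fin 6 → Fin 6) → Injective _≡_ _≡_ ρ →
               GoodColouring (λ x y → κ (ρ x) (ρ y))
relabel-good {κ} good ρ ρ-inj = record
  { symmetric           = λ x y → symmetric (ρ x) (ρ y)
  ; no-monochromatic-K₄ = λ c f f-inj → no-monochromatic-K₄ c (ρ ∘ f) (f-inj ∘ ρ-inj)
  ; colourClass≤10      = λ c → ℕ.≤-trans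
      (pairSum-≤-relabel ρ ρ-inj _ (colourClass κ c) (colourClass-sym symmetric c) (λ _ _ _ → ℕ.≤-refl))
      (colourClass≤10 c)
  }
  where open GoodColouring good

copy-monochromatic : {κ : Fin 6 → Fin 6 → ℕ} → (∀ x y → κ x y ≡ κ y x) → (F : Graph) (φ : Fin (n F) → Fin 6) →
                     Injective _≡_ _≡_ φ → ∀ c →
                     (∀ u v → adj F u v ≡ true → toℕ (φ u) < toℕ (φ v) →
                        adj (K 6) (φ u) (φ v) ≡ true × κ (φ u) (φ v) ≡ c) →
                     Monochromatic κ (adj F) φ c
copy-monochromatic κ-sym F φ φ-inj c mono u v uv with ℕ.<-cmp (toℕ (φ u)) (toℕ (φ v))
... | tri< φu<φv _ _ = proj₂ (mono u v uv φu<φv)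
... | tri> _ _ φv<φu = trans (κ-sym _ _) (proj₂ (mono v u (trans (adjSym F v u) uv) φv<φu))
... | tri≈ _ φu≡φv _ with refl ← φ-inj (toℕ-injective φu≡φv) with () ← trans (sym (irrefl F u)) uv

monochromatic-subgraph-sparse : {κ : Fin 6 → Fin 6 → ℕ} → GoodColouring κ → (H : Graph) (k : ℕ) → n H ≡ 3 + k →
                                (ψ : Fin (n H) → Fin 6) → Injective _≡_ _≡_ ψ → ∀ c → Monochromatic κ (adj H) ψ c →
                                2 * edgeCount H < 5 * suc k + 2
monochromatic-subgraph-sparse good H@(record { adj = a ; adjSym = a-sym }) k refl ψ ψ-inj c mono
  rewrite edgeCount≡pairSum H = monochromatic-sparse good k a a-sym ψ ψ-inj c mono

good⇒no-dense-copy : {κ : Colouring (K 6)} → GoodColouring κ → (𝓕 : Family) →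
                     M2FamilyAtLeast 𝓕 ((+ 5) / 2) → ¬ HasMonoCopy (K 6) 𝓕 κ
good⇒no-dense-copy good 𝓕 dense (F , F∈𝓕 , c , φ , φ-inj , mono) with dense F F∈𝓕
... | _ , (inj₁ refl , _) , 5/2≤½ = from-no ((+ 5) / 2 ℚ.≤? ½) 5/2≤½
... | _ , (inj₂ (S , k , v≡3+k , refl) , _) , 5/2≤q =
  ℕ.<⇒≱ (monochromatic-subgraph-sparse good (H S) k v≡3+k (φ ∘ emb S) (inj S ∘ φ-inj) c
           λ u w uw → copy-monochromatic symmetric F φ φ-inj c mono (emb S u) (emb S w) (pres S u w uw))
        (five-halves-≤⇒ (edgeCount (H S)) k 5/2≤q)
  where open GoodColouring good

-- Colouring K₆ along the perfect matching {01, 23, 45}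

part : Fin 6 → Fin 3
part = Fin.quotient 2

side : Fin 6 → Fin 2
side = Fin.remainder {3} 2

vertex : Fin 3 → Fin 2 → Fin 6
vertex = Fin.combine

side-vertex : ∀ i b → side (vertex i b) ≡ b
side-vertex i b = cong proj₂ (remQuot-combine i b)

vertex-part-side : ∀ x → vertex (part x) (side x) ≡ x
vertex-part-side = combine-remQuot {3} 2

vertex-0≢1 : ∀ i → vertex i 0F ≢ vertex i 1F
vertex-0≢1 i eq with () ← trans (sym (side-vertex i 0F)) (trans (cong side eq) (side-vertex i 1F))

located : ∀ z {i b} → part z ≡ i → side z ≡ b → z ≡ vertex i b
located z pz sz = trans (sym (vertex-part-side z)) (cong₂ vertex pz sz)

same-part : ∀ {x y} → part x ≡ part y → x ≢ y →
            (x ≡ vertex (part x) 0F × y ≡ vertex (part x) 1F) ⊎ (x ≡ vertex (part x) 1F × y ≡ vertex (part x) 0F)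
same-part {x} {y} px≡py x≢y with side x in sx | side y in sy
... | 0F | 0F = ⊥-elim (x≢y (trans (located x refl sx) (sym (located y (sym px≡py) sy))))
... | 1F | 1F = ⊥-elim (x≢y (trans (located x refl sx) (sym (located y (sym px≡py) sy))))
... | 0F | 1F = inj₁ (located x refl sx , located y (sym px≡py) sy)
... | 1F | 0F = inj₂ (located x refl sx , located y (sym px≡py) sy)

no-three-in-part : ∀ {x y z} → part x ≡ part y → part x ≡ part z → x ≢ y → x ≢ z → y ≢ z → ⊥
no-three-in-part {x} pxy pxz x≢y x≢z y≢z with same-part pxy x≢y | same-part pxz x≢z
... | inj₁ (_ , y≡) | inj₁ (_ , z≡) = y≢z (trans y≡ (sym z≡))
... | inj₂ (_ , y≡) | inj₂ (_ , z≡) = y≢z (trans y≡ (sym z≡))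
... | inj₁ (x≡0 , _) | inj₂ (x≡1 , _) = vertex-0≢1 (part x) (trans (sym x≡0) x≡1)
... | inj₂ (x≡1 , _) | inj₁ (x≡0 , _) = vertex-0≢1 (part x) (trans (sym x≡0) x≡1)

next : Fin 3 → Fin 3
next 0F = 1F
next 1F = 2F
next 2F = 0F

-- The cyclic tournament on the three parts: i beats next i.
winner : Fin 3 → Fin 3 → Fin 3
winner i j = if does (j ≟ next i) then i else j

winner-comm : ∀ i j → winner i j ≡ winner j i
winner-comm 0F 0F = refl
winner-comm 0F 1F = refl
winner-comm 0F 2F = refl
winner-comm 1F 0F = refl
winner-comm 1F 1F = refl
winner-comm 1F 2F = refl
winner-comm 2F 0F = refl
winner-comm 2F 1F = refl
winner-comm 2F 2F = refl

winner-either : ∀ i j → winner i j ≡ i ⊎ winner i j ≡ j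
winner-either i j with does (j ≟ next i)
... | true  = inj₁ refl
... | false = inj₂ refl

winner≡⇒next : ∀ {i j} → j ≢ i → winner i j ≡ i → j ≡ next i
winner≡⇒next {i} {j} j≢i w≡i with j ≟ next i
... | yes j≡next = j≡next
... | no _       = ⊥-elim (j≢i w≡i)

next≢ : ∀ i → next i ≢ i
next≢ 0F ()
next≢ 1F ()
next≢ 2F ()

prev : Fin 3 → Fin 3
prev i = next (next i)

prev≢ : ∀ i → prev i ≢ i
prev≢ 0F ()
prev≢ 1F ()
prev≢ 2F ()

loses-to-prev : ∀ i → winner i (prev i) ≢ i
loses-to-prev 0F ()
loses-to-prev 1F ()
loses-to-prev 2F ()

_∈₂_ : ℕ → ℕ × ℕ → Set
c ∈₂ l = c ≡ proj₁ l ⊎ c ≡ proj₂ l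

_∈₂?_ : ∀ c l → Dec (c ∈₂ l)
c ∈₂? l = (c ℕ.≟ proj₁ l) ⊎-dec (c ℕ.≟ proj₂ l)

∈₂-at-most-two : ∀ {a b c l} → a ≢ b → a ≢ c → b ≢ c → a ∈₂ l → b ∈₂ l → c ∈₂ l → ⊥
∈₂-at-most-two a≢b a≢c b≢c (inj₁ refl) (inj₁ refl) _           = a≢b refl
∈₂-at-most-two a≢b a≢c b≢c (inj₂ refl) (inj₂ refl) _           = a≢b refl
∈₂-at-most-two a≢b a≢c b≢c (inj₁ refl) (inj₂ refl) (inj₁ refl) = a≢c refl
∈₂-at-most-two a≢b a≢c b≢c (inj₁ refl) (inj₂ refl) (inj₂ refl) = b≢c refl
∈₂-at-most-two a≢b a≢c b≢c (inj₂ refl) (inj₁ refl) (inj₁ refl) = b≢c refl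
∈₂-at-most-two a≢b a≢c b≢c (inj₂ refl) (inj₁ refl) (inj₂ refl) = a≢c refl

other : ℕ → ℕ × ℕ → ℕ
other c (p , q) with p ℕ.≟ c
... | yes _ = q
... | no _  = p

other-∈ : ∀ c l → other c l ∈₂ l
other-∈ c (p , q) with p ℕ.≟ c
... | yes _ = inj₂ refl
... | no _  = inj₁ refl

other-≢ : ∀ c l → proj₁ l ≢ proj₂ l → other c l ≢ c
other-≢ c (p , q) p≢q with p ℕ.≟ c
... | yes refl = λ q≡p → p≢q (sym q≡p)
... | no p≢c   = p≢c

entryAvoiding : ℕ × ℕ → ℕ × ℕ → ℕ → ℕ
entryAvoiding (p , q) ab w with p ∈₂? ab | q ∈₂? ab
... | no _  | _     = p
... | yes _ | no _  = q
... | yes _ | yes _ = w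

entryAvoiding-swap : ∀ l a b w → entryAvoiding l (a , b) w ≡ entryAvoiding l (b , a) w
entryAvoiding-swap (p , q) a b w with p ∈₂? (a , b) | q ∈₂? (a , b) | p ∈₂? (b , a) | q ∈₂? (b , a)
... | no _  | _     | no _  | _     = refl
... | yes _ | no _  | yes _ | no _  = refl
... | yes _ | yes _ | yes _ | yes _ = refl
... | yes p∈ | _     | no p∉ | _     = ⊥-elim (p∉ (Sum.swap p∈))
... | no p∉  | _     | yes p∈ | _    = ⊥-elim (p∉ (Sum.swap p∈))
... | yes _ | yes q∈ | yes _ | no q∉ = ⊥-elim (q∉ (Sum.swap q∈))
... | yes _ | no q∉  | yes _ | yes q∈ = ⊥-elim (q∉ (Sum.swap q∈))

entryAvoiding-∈ : ∀ l ab w → proj₁ l ≢ proj₂ l → w ∈₂ ab → entryAvoiding l ab w ∈₂ l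
entryAvoiding-∈ (p , q) ab w p≢q w∈ab with p ∈₂? ab | q ∈₂? ab
... | no _    | _      = inj₁ refl
... | yes _   | no _   = inj₂ refl
... | yes p∈ | yes q∈ = fill p∈ q∈ w∈ab
  where
  fill : p ∈₂ ab → q ∈₂ ab → w ∈₂ ab → w ∈₂ (p , q)
  fill (inj₁ refl) _           (inj₁ refl) = inj₁ refl
  fill (inj₂ refl) _           (inj₂ refl) = inj₁ refl
  fill (inj₁ refl) (inj₂ refl) (inj₂ refl) = inj₂ refl
  fill (inj₂ refl) (inj₁ refl) (inj₁ refl) = inj₂ refl
  fill (inj₁ refl) (inj₁ refl) _           = ⊥-elim (p≢q refl)
  fill (inj₂ refl) (inj₂ refl) _           = ⊥-elim (p≢q refl)

entryAvoiding-∈-avoided : ∀ l ab w → proj₁ l ≢ proj₂ l → entryAvoiding l ab w ∈₂ ab →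
                          proj₁ ab ≢ proj₂ ab × entryAvoiding l ab w ≡ w
entryAvoiding-∈-avoided (p , q) ab w p≢q chosen∈ab with p ∈₂? ab | q ∈₂? ab
... | no p∉  | _      = ⊥-elim (p∉ chosen∈ab)
... | yes _  | no q∉  = ⊥-elim (q∉ chosen∈ab)
... | yes p∈ | yes q∈ = distinct p∈ q∈ , refl
  where
  distinct : p ∈₂ ab → q ∈₂ ab → proj₁ ab ≢ proj₂ ab
  distinct (inj₁ refl) (inj₁ refl) _  = p≢q refl
  distinct (inj₂ refl) (inj₂ refl) _  = p≢q refl
  distinct (inj₁ refl) (inj₂ refl) eq = p≢q eq
  distinct (inj₂ refl) (inj₁ refl) eq = p≢q (sym eq)

occurrences : (Fin 6 → Fin 6 → ℕ × ℕ) → ℕ → ℕ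
occurrences L c = pairSum 6 (λ x y → 𝟙 (does (c ∈₂? L x y)))

occurrences-permute : (L : Fin 6 → Fin 6 → ℕ × ℕ) → (∀ x y → L x y ≡ L y x) → (π : Permutation 6 6) → ∀ c →
                      occurrences (λ x y → L (π ⟨$⟩ʳ x) (π ⟨$⟩ʳ y)) c ≡ occurrences L c
occurrences-permute L L-sym π c =
  pairSum-permute π (λ x y → 𝟙 (does (c ∈₂? L x y))) λ x y → cong (λ l → 𝟙 (does (c ∈₂? l))) (L-sym x y)

Excluded : Fin 3 → Fin 3 → Fin 6 → Fin 6 → Set
Excluded i j x y = (part x ≡ j × part y ≡ j) ⊎ (part x ≡ i × part y ≡ prev i) ⊎ (part x ≡ prev i × part y ≡ i)

excluded? : ∀ i j x y → Dec (Excluded i j x y)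
excluded? i j x y = ((part x ≟ j) ×-dec (part y ≟ j)) ⊎-dec ((part x ≟ i) ×-dec (part y ≟ prev i))
                                                     ⊎-dec ((part x ≟ prev i) ×-dec (part y ≟ i))

unexcluded≤10 : ∀ i j → j ≢ i → pairSum 6 (λ x y → 𝟙 (not (does (excluded? i j x y)))) ≤ 10
unexcluded≤10 0F 0F j≢i = ⊥-elim (j≢i refl)
unexcluded≤10 1F 1F j≢i = ⊥-elim (j≢i refl)
unexcluded≤10 2F 2F j≢i = ⊥-elim (j≢i refl)
unexcluded≤10 0F 1F _ = ℕ.≤-refl
unexcluded≤10 0F 2F _ = ℕ.≤-refl
unexcluded≤10 1F 0F _ = ℕ.≤-refl
unexcluded≤10 1F 2F _ = ℕ.≤-refl
unexcluded≤10 2F 0F _ = ℕ.≤-refl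
unexcluded≤10 2F 1F _ = ℕ.≤-refl

module PartColouring (L : Fin 6 → Fin 6 → ℕ × ℕ) (L-sym : ∀ x y → L x y ≡ L y x)
                     (L-proper : ∀ x y → x ≢ y → proj₁ (L x y) ≢ proj₂ (L x y))
                     (M : Fin 3 → ℕ) where

  κ : Fin 6 → Fin 6 → ℕ
  κ x y with part x ≟ part y
  ... | yes _ = M (part x)
  ... | no _  = entryAvoiding (L x y) (M (part x) , M (part y)) (M (winner (part x) (part y)))

  κ-inner : ∀ x y → part x ≡ part y → κ x y ≡ M (part x)
  κ-inner x y px≡py with part x ≟ part y
  ... | yes _    = refl
  ... | no px≢py = ⊥-elim (px≢py px≡py)

  κ-cross : ∀ x y → part x ≢ part y →
            κ x y ≡ entryAvoiding (L x y) (M (part x) , M (part y)) (M (winner (part x) (part y)))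
  κ-cross x y px≢py with part x ≟ part y
  ... | yes px≡py = ⊥-elim (px≢py px≡py)
  ... | no _      = refl

  κ-sym : ∀ x y → κ x y ≡ κ y x
  κ-sym x y with part x ≟ part y | part y ≟ part x
  ... | yes px≡py | yes _     = cong M px≡py
  ... | no px≢py  | no _      = begin
    entryAvoiding (L x y) (M (part x) , M (part y)) (M (winner (part x) (part y)))
      ≡⟨ cong₂ (λ l w → entryAvoiding l (M (part x) , M (part y)) (M w)) (L-sym x y) (winner-comm (part x) (part y)) ⟩
    entryAvoiding (L y x) (M (part x) , M (part y)) (M (winner (part y) (part x)))
      ≡⟨ entryAvoiding-swap (L y x) (M (part x)) (M (part y)) _ ⟩
    entryAvoiding (L y x) (M (part y) , M (part x)) (M (winner (part y) (part x)))
      ∎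
    where open ≡-Reasoning
  ... | yes px≡py | no py≢px  = ⊥-elim (py≢px (sym px≡py))
  ... | no px≢py  | yes py≡px = ⊥-elim (px≢py (sym py≡px))

  κ-cross-own : ∀ x y → part x ≢ part y → κ x y ≡ M (part x) →
                M (part x) ≢ M (part y) × winner (part x) (part y) ≡ part x
  κ-cross-own x y px≢py κ≡ with entryAvoiding-∈-avoided (L x y) (M (part x) , M (part y)) _
                                      (L-proper x y (px≢py ∘ cong part)) (inj₁ (trans (sym (κ-cross x y px≢py)) κ≡))
  ... | Mx≢My , chosen≡ with winner-either (part x) (part y)
  ...   | inj₁ w≡x = Mx≢My , w≡x
  ...   | inj₂ w≡y = ⊥-elim (Mx≢My (trans (sym κ≡) (trans (κ-cross x y px≢py) (trans chosen≡ (cong M w≡y)))))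

  κ-∈ : (∀ i → M i ∈₂ L (vertex i 0F) (vertex i 1F)) → ∀ x y → x ≢ y → κ x y ∈₂ L x y
  κ-∈ M∈ x y x≢y with part x ≟ part y
  ... | no px≢py =
    entryAvoiding-∈ (L x y) _ _ (L-proper x y x≢y) (Sum.map (cong M) (cong M) (winner-either (part x) (part y)))
  ... | yes px≡py with same-part px≡py x≢y
  ...   | inj₁ (x≡ , y≡) = subst₂ (λ a b → M (part x) ∈₂ L a b) (sym x≡) (sym y≡) (M∈ (part x))
  ...   | inj₂ (x≡ , y≡) =
    subst₂ (λ a b → M (part x) ∈₂ L a b) (sym x≡) (sym y≡) (subst (M (part x) ∈₂_) (L-sym _ _) (M∈ (part x)))

  κ-no-monochromatic-K₄ : ∀ c (f : Fin 4 → Fin 6) → Injective _≡_ _≡_ f → ¬ (∀ i j → i ≢ j → κ (f i) (f j) ≡ c)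
  κ-no-monochromatic-K₄ c f f-inj mono with pigeonhole (ℕ.s≤s (ℕ.s≤s (ℕ.s≤s (ℕ.s≤s z≤n)))) (part ∘ f)
  ... | i , j , i<j , same = proj₁ (beaten 0F) (begin
    M (part (f i))           ≡⟨ κ-inner (f i) (f j) same ⟨
    κ (f i) (f j)            ≡⟨ mono i j i≢j ⟩
    c                        ≡⟨ mono (u 0F) (u 1F) u₀≢u₁ ⟨
    κ (f (u 0F)) (f (u 1F))  ≡⟨ κ-inner (f (u 0F)) (f (u 1F)) (trans (proj₂ (beaten 0F)) (sym (proj₂ (beaten 1F)))) ⟩
    M (part (f (u 0F)))      ∎)
    where
    open ≡-Reasoning
    i≢j : i ≢ j
    i≢j = <⇒≢ i<j
    u : Fin 2 → Fin 4
    u = others i j i≢j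
    u₀≢u₁ : u 0F ≢ u 1F
    u₀≢u₁ eq with () ← others-injective i≢j eq
    -- Two vertices of the K₄ share a part, which beats the parts of both other vertices; so these share a part.
    beaten : ∀ l → M (part (f i)) ≢ M (part (f (u l))) × part (f (u l)) ≡ next (part (f i))
    beaten l = proj₁ own , winner≡⇒next {part (f i)} (pi≢pu ∘ sym) (proj₂ own)
      where
      fi≢fu : f i ≢ f (u l)
      fi≢fu = others≢ˡ i≢j l ∘ sym ∘ f-inj
      pi≢pu : part (f i) ≢ part (f (u l))
      pi≢pu pi≡pu = no-three-in-part same pi≡pu (i≢j ∘ f-inj) fi≢fu (others≢ʳ i≢j l ∘ sym ∘ f-inj)
      own : M (part (f i)) ≢ M (part (f (u l))) × winner (part (f i)) (part (f (u l))) ≡ part (f i)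
      own = κ-cross-own (f i) (f (u l)) pi≢pu
              (trans (mono i (u l) (fi≢fu ∘ cong f)) (trans (sym (mono i j i≢j)) (κ-inner (f i) (f j) same)))

  κ-prev-avoids : ∀ {i} x y → part x ≡ i → part y ≡ prev i → κ x y ≢ M i
  κ-prev-avoids {i} x y refl py≡ κ≡ =
    loses-to-prev i (subst (λ p → winner i p ≡ i) py≡ (proj₂ (κ-cross-own x y px≢py κ≡)))
    where
    px≢py : part x ≢ part y
    px≢py px≡py = prev≢ i (sym (trans px≡py py≡))

  κ-avoids : ∀ {i j} → M j ≢ M i → ∀ x y → Excluded i j x y → κ x y ≢ M i
  κ-avoids Mj≢Mi x y (inj₁ (px≡j , py≡j)) κ≡Mi =
    Mj≢Mi (trans (sym (trans (κ-inner x y (trans px≡j (sym py≡j))) (cong M px≡j))) κ≡Mi)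
  κ-avoids _ x y (inj₂ (inj₁ (px≡i , py≡prev))) κ≡Mi = κ-prev-avoids x y px≡i py≡prev κ≡Mi
  κ-avoids _ x y (inj₂ (inj₂ (px≡prev , py≡i))) κ≡Mi = κ-prev-avoids y x py≡i px≡prev (trans (κ-sym y x) κ≡Mi)

  colourClass-M≤10 : ∀ {i j} → M j ≢ M i → pairSum 6 (colourClass κ (M i)) ≤ 10
  colourClass-M≤10 {i} {j} Mj≢Mi = ℕ.≤-trans (pairSum-mono bound) (unexcluded≤10 i j (Mj≢Mi ∘ cong M))
    where
    bound : ∀ x y → toℕ x < toℕ y → colourClass κ (M i) x y ≤ 𝟙 (not (does (excluded? i j x y)))
    bound x y _ with excluded? i j x y
    ... | yes ex rewrite dec-false (κ x y ℕ.≟ M i) (κ-avoids Mj≢Mi x y ex) = z≤n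
    ... | no ¬ex rewrite dec-false (excluded? i j x y) ¬ex = 𝟙≤1 _

  colourClass≤occurrences : (∀ i → M i ∈₂ L (vertex i 0F) (vertex i 1F)) → ∀ c →
                            pairSum 6 (colourClass κ c) ≤ occurrences L c
  colourClass≤occurrences M∈ c = pairSum-mono bound
    where
    bound : ∀ x y → toℕ x < toℕ y → colourClass κ c x y ≤ 𝟙 (does (c ∈₂? L x y))
    bound x y x<y with κ x y ℕ.≟ c
    ... | no κ≢c  rewrite dec-false (κ x y ℕ.≟ c) κ≢c = z≤n
    ... | yes κ≡c rewrite dec-true (κ x y ℕ.≟ c) κ≡c
                        | dec-true (c ∈₂? L x y) (subst (_∈₂ L x y) κ≡c (κ-∈ M∈ x y (ℕ.<⇒≢ x<y ∘ cong toℕ)))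
                        = ℕ.≤-refl

  κ-good : (∀ i → M i ∈₂ L (vertex i 0F) (vertex i 1F)) → (∀ i → ∃ λ j → M j ≢ M i) →
           (∀ c → (∀ i → M i ≢ c) → occurrences L c ≤ 10) → GoodColouring κ
  κ-good M∈ M-varies light = record
    { symmetric           = κ-sym
    ; no-monochromatic-K₄ = κ-no-monochromatic-K₄
    ; colourClass≤10      = class≤10
    }
    where
    class≤10 : ∀ c → pairSum 6 (colourClass κ c) ≤ 10
    class≤10 c with any? (λ i → M i ℕ.≟ c)
    ... | yes (i , refl) = colourClass-M≤10 (proj₂ (M-varies i))
    ... | no ∄i          = ℕ.≤-trans (colourClass≤occurrences M∈ c) (light c λ i Mi≡c → ∄i (i , Mi≡c))

-- Choosing the matching and its colours

-- relabel k sends the parts {0,1}, {2,3}, {4,5} to the k-th perfect matching of the one-factorisation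
-- {01,23,45}, {02,14,35}, {03,15,24}, {04,13,25}, {05,12,34} of K₆.
relabel : Fin 5 → Fin 6 → Fin 6
relabel k = Vec.lookup (matching k)
  where
  matching : Fin 5 → Vec (Fin 6) 6
  matching 0F = 0F ∷ 1F ∷ 2F ∷ 3F ∷ 4F ∷ 5F ∷ []
  matching 1F = 0F ∷ 2F ∷ 1F ∷ 4F ∷ 3F ∷ 5F ∷ []
  matching 2F = 0F ∷ 3F ∷ 1F ∷ 5F ∷ 2F ∷ 4F ∷ []
  matching 3F = 0F ∷ 4F ∷ 1F ∷ 3F ∷ 2F ∷ 5F ∷ []
  matching 4F = 0F ∷ 5F ∷ 1F ∷ 2F ∷ 3F ∷ 4F ∷ []

matchingEnd : Fin 5 → Fin 3 → Fin 2 → Fin 6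
matchingEnd k t b = relabel k (vertex t b)

relabel-injective : ∀ k → Injective _≡_ _≡_ (relabel k)
relabel-injective k {x} {y} =
  from-yes (all? λ k → all? λ x → all? λ y → (relabel k x ≟ relabel k y) →-dec (x ≟ y)) k x y

pairSum-oneFactorisation : (g : Fin 6 → Fin 6 → ℕ) →
  pairSum 6 g ≡ ∑[ k < 5 ] ∑[ t < 3 ] g (matchingEnd k t 0F) (matchingEnd k t 1F)
pairSum-oneFactorisation g = regroup (g 0F 1F) (g 0F 2F) (g 0F 3F) (g 0F 4F) (g 0F 5F) (g 1F 2F) (g 1F 3F)
                                     (g 1F 4F) (g 1F 5F) (g 2F 3F) (g 2F 4F) (g 2F 5F) (g 3F 4F) (g 3F 5F) (g 4F 5F)
  where
  regroup : ∀ a01 a02 a03 a04 a05 a12 a13 a14 a15 a23 a24 a25 a34 a35 a45 →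
    (a01 + (a02 + (a03 + (a04 + (a05 + 0))))) + ((a12 + (a13 + (a14 + (a15 + 0)))) +
      ((a23 + (a24 + (a25 + 0))) + ((a34 + (a35 + 0)) + ((a45 + 0) + 0))))
    ≡ (a01 + (a23 + (a45 + 0))) + ((a02 + (a14 + (a35 + 0))) + ((a03 + (a15 + (a24 + 0))) +
      ((a04 + (a13 + (a25 + 0))) + ((a05 + (a12 + (a34 + 0))) + 0))))
  regroup = ℕ-Solver.solve-∀

∑-rotate : (f : Fin 3 → ℕ) → ∑[ t < 3 ] f (next t) ≡ ∑[ t < 3 ] f t
∑-rotate f = cycle (f 0F) (f 1F) (f 2F)
  where
  cycle : ∀ a b c → b + (c + (a + 0)) ≡ a + (b + (c + 0))
  cycle = ℕ-Solver.solve-∀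

-- If no slot t of a matching has P on t and Q on next t, each of the 15 slots contributes at most 1 to
-- "P on t plus Q on next t", and by the one-factorisation these contributions add up to the two edge counts.
opaque
  matching-slots : {P Q : Fin 6 → Fin 6 → Set} (P? : ∀ x y → Dec (P x y)) (Q? : ∀ x y → Dec (Q x y)) →
                   15 < pairSum 6 (λ x y → 𝟙 (does (P? x y))) + pairSum 6 (λ x y → 𝟙 (does (Q? x y))) →
                   ∃₂ λ k t → P (matchingEnd k t 0F) (matchingEnd k t 1F)
                            × Q (matchingEnd k (next t) 0F) (matchingEnd k (next t) 1F)
  matching-slots {P} {Q} P? Q? 15<
    with any? (λ k → any? (λ t → P? (matchingEnd k t 0F) (matchingEnd k t 1F)
                               ×-dec Q? (matchingEnd k (next t) 0F) (matchingEnd k (next t) 1F)))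
  ... | yes found = found
  ... | no none = ⊥-elim (ℕ.<-irrefl refl (ℕ.<-≤-trans 15< (begin
    pairSum 6 p + pairSum 6 q
      ≡⟨ cong₂ _+_ (pairSum-oneFactorisation p) (pairSum-oneFactorisation q) ⟩
    ∑[ k < 5 ] ∑[ t < 3 ] p (e₀ k t) (e₁ k t) + ∑[ k < 5 ] ∑[ t < 3 ] q (e₀ k t) (e₁ k t)
      ≡⟨ cong (∑[ k < 5 ] ∑[ t < 3 ] p (e₀ k t) (e₁ k t) ℕ.+_) (sum-cong-≗ λ k → ∑-rotate (λ t → q (e₀ k t) (e₁ k t))) ⟨
    ∑[ k < 5 ] ∑[ t < 3 ] p (e₀ k t) (e₁ k t) + ∑[ k < 5 ] ∑[ t < 3 ] q (e₀ k (next t)) (e₁ k (next t))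
      ≡⟨ trans (sum-cong-≗ λ k → ∑-distrib-+ (P-at k) (Q-next k)) (∑-distrib-+ (sum ∘ P-at) (sum ∘ Q-next)) ⟨
    ∑[ k < 5 ] ∑[ t < 3 ] (p (e₀ k t) (e₁ k t) + q (e₀ k (next t)) (e₁ k (next t)))
      ≤⟨ ∑-mono-≤ (λ k → ∑-mono-≤ (λ t → at-most-one k t)) ⟩
    15 ∎)))
    where
    open ℕ.≤-Reasoning
    e₀ e₁ : Fin 5 → Fin 3 → Fin 6
    e₀ k t = matchingEnd k t 0F
    e₁ k t = matchingEnd k t 1F
    p q : Fin 6 → Fin 6 → ℕ
    p x y = 𝟙 (does (P? x y))
    q x y = 𝟙 (does (Q? x y))
    P-at Q-next : Fin 5 → Fin 3 → ℕ
    P-at k t = p (e₀ k t) (e₁ k t)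
    Q-next k t = q (e₀ k (next t)) (e₁ k (next t))
    at-most-one : ∀ k t → p (e₀ k t) (e₁ k t) + q (e₀ k (next t)) (e₁ k (next t)) ≤ 1
    at-most-one k t with P? (matchingEnd k t 0F) (matchingEnd k t 1F) | Q? (matchingEnd k (next t) 0F) (matchingEnd k (next t) 1F)
    ... | yes Pt | yes Qt = ⊥-elim (none (k , t , Pt , Qt))
    ... | yes _  | no _   = ℕ.≤-refl
    ... | no _   | _      = 𝟙≤1 _

module Selection (L : Fin 6 → Fin 6 → ℕ × ℕ) (L-sym : ∀ x y → L x y ≡ L y x)
                 (L-proper : ∀ x y → x ≢ y → proj₁ (L x y) ≢ proj₂ (L x y)) where

  Heavy : ℕ → Set
  Heavy c = 10 < occurrences L c

  heavy? : ∀ c → Dec (Heavy c)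
  heavy? c = 10 ℕ.<? occurrences L c

  record ColouringPlan : Set where
    field
      k          : Fin 5
      M          : Fin 3 → ℕ
      M∈         : ∀ i → M i ∈₂ L (matchingEnd k i 0F) (matchingEnd k i 1F)
      M-varies   : ∀ i → ∃ λ j → M j ≢ M i
      heavy-used : ∀ c → Heavy c → ∃ λ i → M i ≡ c

  edge-proper : ∀ k t → let l = L (matchingEnd k t 0F) (matchingEnd k t 1F) in proj₁ l ≢ proj₂ l
  edge-proper k t = L-proper _ _ (vertex-0≢1 t ∘ relabel-injective k)

  module FromSlots (k : Fin 5) (t : Fin 3) (a b : ℕ)
                   (a∈ : a ∈₂ L (matchingEnd k t 0F) (matchingEnd k t 1F))
                   (b∈ : b ∈₂ L (matchingEnd k (next t) 0F) (matchingEnd k (next t) 1F))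
                   (a≢b : a ≢ b) (heavy∈ : ∀ c → Heavy c → c ≡ a ⊎ c ≡ b) where

    M : Fin 3 → ℕ
    M i with i ≟ t | i ≟ next t
    ... | yes _ | _     = a
    ... | no _  | yes _ = b
    ... | no _  | no _  = proj₁ (L (matchingEnd k i 0F) (matchingEnd k i 1F))

    M∈ : ∀ i → M i ∈₂ L (matchingEnd k i 0F) (matchingEnd k i 1F)
    M∈ i with i ≟ t | i ≟ next t
    ... | yes refl | _        = a∈
    ... | no _     | yes refl = b∈
    ... | no _     | no _     = inj₁ refl

    M-t : M t ≡ a
    M-t with t ≟ t
    ... | yes _  = refl
    ... | no t≢t = ⊥-elim (t≢t refl)

    M-next : M (next t) ≡ b
    M-next with next t ≟ t | next t ≟ next t
    ... | yes nt≡t | _     = ⊥-elim (next≢ t nt≡t)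
    ... | no _     | yes _ = refl
    ... | no _     | no ¬r = ⊥-elim (¬r refl)

    plan : ColouringPlan
    plan = record
      { k          = k
      ; M          = M
      ; M∈         = M∈
      ; M-varies   = varies
      ; heavy-used = λ c heavy → [ (λ c≡a → t , trans M-t (sym c≡a)) , (λ c≡b → next t , trans M-next (sym c≡b)) ]′
                                   (heavy∈ c heavy)
      }
      where
      varies : ∀ i → ∃ λ j → M j ≢ M i
      varies i with M i ℕ.≟ a
      ... | yes Mi≡a = next t , λ Mn≡Mi → a≢b (trans (sym Mi≡a) (trans (sym Mn≡Mi) M-next))
      ... | no Mi≢a  = t , λ Mt≡Mi → Mi≢a (trans (sym Mt≡Mi) M-t)

  listed : ∀ c → 0 < occurrences L c → ∃₂ λ x y → c ∈₂ L x y
  listed c 0<occ with any? (λ x → any? (λ y → c ∈₂? L x y))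
  ... | yes found = found
  ... | no none = ⊥-elim (ℕ.<-irrefl refl (ℕ.<-≤-trans 0<occ (pairSum-mono {g = λ _ _ → 0} absent)))
    where
    absent : ∀ x y → toℕ x < toℕ y → 𝟙 (does (c ∈₂? L x y)) ≤ 0
    absent x y _ rewrite dec-false (c ∈₂? L x y) (λ c∈ → none (x , y , c∈)) = z≤n

  -- Only the finitely many listed colours need to be searched.
  opaque
    search : {P : ℕ → Set} → (∀ c → Dec (P c)) → (∀ c → P c → 0 < occurrences L c) → Dec (∃ P)
    search {P} P? listed-if with any? (λ x → any? (λ y → P? (proj₁ (L x y)) ⊎-dec P? (proj₂ (L x y))))
    ... | yes (x , y , inj₁ p) = yes (_ , p)
    ... | yes (x , y , inj₂ p) = yes (_ , p)
    ... | no none = no λ (c , pc) → let (x , y , c∈) = listed c (listed-if c pc) in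
                      none (x , y , Sum.map (λ c≡ → subst P c≡ pc) (λ c≡ → subst P c≡ pc) c∈)

  occurrences-three : ∀ {a b c} → a ≢ b → a ≢ c → b ≢ c → occurrences L a + occurrences L b + occurrences L c ≤ 30
  occurrences-three {a} {b} {c} a≢b a≢c b≢c = begin
    occurrences L a + occurrences L b + occurrences L c
      ≡⟨ cong (_+ occurrences L c) (pairSum-+ (count a) (count b)) ⟨
    pairSum 6 (λ x y → count a x y + count b x y) + occurrences L c
      ≡⟨ pairSum-+ (λ x y → count a x y + count b x y) (count c) ⟨
    pairSum 6 (λ x y → count a x y + count b x y + count c x y)
      ≤⟨ pairSum-mono {g = λ _ _ → 2} (λ x y _ → 𝟙-sum≤2 _ _ _ (not-all (L x y))) ⟩
    30 ∎
    where
    open ℕ.≤-Reasoning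
    count : ℕ → Fin 6 → Fin 6 → ℕ
    count d x y = 𝟙 (does (d ∈₂? L x y))
    not-all : ∀ l → ¬ (does (a ∈₂? l) ≡ true × does (b ∈₂? l) ≡ true × does (c ∈₂? l) ≡ true)
    not-all l (a∈ , b∈ , c∈) =
      ∈₂-at-most-two a≢b a≢c b≢c (does-true (a ∈₂? l) a∈) (does-true (b ∈₂? l) b∈) (does-true (c ∈₂? l) c∈)

  heavy⇒listed : ∀ c → Heavy c → 0 < occurrences L c
  heavy⇒listed c heavy = ℕ.≤-trans (s≤s z≤n) heavy

  plan-without-heavy : (∀ c → ¬ Heavy c) → ColouringPlan
  plan-without-heavy none with matching-slots (λ _ _ → yes tt) (λ _ _ → yes tt) (from-yes (15 ℕ.<? 30))
  ... | k , t , _ , _ = FromSlots.plan k t a (other a l) (inj₁ refl) (other-∈ a l)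
                          (λ a≡ → other-≢ a l (edge-proper k (next t)) (sym a≡)) (λ c heavy → ⊥-elim (none c heavy))
    where
    a : ℕ
    a = proj₁ (L (matchingEnd k t 0F) (matchingEnd k t 1F))
    l : ℕ × ℕ
    l = L (matchingEnd k (next t) 0F) (matchingEnd k (next t) 1F)

  plan-one-heavy : ∀ {h} → Heavy h → (∀ c → Heavy c → c ≡ h) → ColouringPlan
  plan-one-heavy {h} heavy only with matching-slots (λ x y → h ∈₂? L x y) (λ _ _ → yes tt)
                                                     (ℕ.+-monoˡ-≤ 15 (heavy⇒listed h heavy))
  ... | k , t , h∈ , _ = FromSlots.plan k t h (other h l) h∈ (other-∈ h l)
                          (λ h≡ → other-≢ h l (edge-proper k (next t)) (sym h≡)) (λ c heavy → inj₁ (only c heavy))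
    where
    l : ℕ × ℕ
    l = L (matchingEnd k (next t) 0F) (matchingEnd k (next t) 1F)

  plan-two-heavy : ∀ {h h′} → Heavy h → Heavy h′ → h ≢ h′ → ColouringPlan
  plan-two-heavy {h} {h′} heavy heavy′ h≢h′
    with matching-slots (λ x y → h ∈₂? L x y) (λ x y → h′ ∈₂? L x y)
                        (ℕ.≤-trans (from-yes (16 ℕ.≤? 22)) (ℕ.+-mono-≤ heavy heavy′))
  ... | k , t , h∈ , h′∈ = FromSlots.plan k t h h′ h∈ h′∈ h≢h′ at-most-two-heavy
    where
    at-most-two-heavy : ∀ c → Heavy c → c ≡ h ⊎ c ≡ h′
    at-most-two-heavy c heavy″ with c ℕ.≟ h | c ℕ.≟ h′
    ... | yes c≡h | _        = inj₁ c≡h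
    ... | no _    | yes c≡h′ = inj₂ c≡h′
    ... | no c≢h  | no c≢h′  = ⊥-elim (ℕ.≤⇒≯ (occurrences-three h≢h′ (c≢h ∘ sym) (c≢h′ ∘ sym))
                                 (ℕ.≤-trans (from-yes (31 ℕ.≤? 33)) (ℕ.+-mono-≤ (ℕ.+-mono-≤ heavy heavy′) heavy″)))

  opaque
    plan : ColouringPlan
    plan with search heavy? heavy⇒listed
    ... | no ∄heavy = plan-without-heavy λ c heavy → ∄heavy (c , heavy)
    ... | yes (h , heavy) with search (λ c → heavy? c ×-dec ¬? (c ℕ.≟ h)) (λ c → heavy⇒listed c ∘ proj₁)
    ...   | no ∄other =
      plan-one-heavy heavy λ c heavy′ → decidable-stable (c ℕ.≟ h) λ c≢h → ∄other (c , heavy′ , c≢h)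
    ...   | yes (h′ , heavy′ , h′≢h) = plan-two-heavy heavy heavy′ (h′≢h ∘ sym)

-- Valid2Lists constrains a list assignment only on the pairs i < j.
symmetrise : (Fin v → Fin v → A) → Fin v → Fin v → A
symmetrise f x y = if toℕ x <ᵇ toℕ y then f x y else f y x

symmetrise-< : (f : Fin v → Fin v → A) {x y : Fin v} → toℕ x < toℕ y → symmetrise f x y ≡ f x y
symmetrise-< f x<y rewrite <ᵇ≡true x<y = refl

symmetrise-≮ : (f : Fin v → Fin v → A) {x y : Fin v} → ¬ toℕ x < toℕ y → symmetrise f x y ≡ f y x
symmetrise-≮ f x≮y rewrite <ᵇ≡false x≮y = refl

symmetrise-sym : (f : Fin v → Fin v → A) → ∀ x y → symmetrise f x y ≡ symmetrise f y x
symmetrise-sym f x y with ℕ.<-cmp (toℕ x) (toℕ y)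
... | tri< x<y _ y≮x = trans (symmetrise-< f x<y) (sym (symmetrise-≮ f y≮x))
... | tri> x≮y _ y<x = trans (symmetrise-≮ f x≮y) (sym (symmetrise-< f y<x))
... | tri≈ _ x≡y _ with refl ← toℕ-injective x≡y = refl

K-adjacent : ∀ {m} {x y : Fin m} → x ≢ y → adj (K m) x y ≡ true
K-adjacent {x = x} {y} x≢y rewrite dec-false (x ≟ y) x≢y = refl

symmetrise-proper : (L : ListAssignment (K 6)) → Valid2Lists (K 6) L →
                    ∀ x y → x ≢ y → proj₁ (symmetrise L x y) ≢ proj₂ (symmetrise L x y)
symmetrise-proper L valid x y x≢y with ℕ.<-cmp (toℕ x) (toℕ y)
... | tri< x<y _ _   rewrite symmetrise-< L x<y = valid x y (K-adjacent x≢y , x<y)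
... | tri> x≮y _ y<x rewrite symmetrise-≮ L x≮y = valid y x (K-adjacent (x≢y ∘ sym) , y<x)
... | tri≈ _ x≡y _   = ⊥-elim (x≢y (toℕ-injective x≡y))

opaque
  good-colouring-from-lists : (L : ListAssignment (K 6)) → Valid2Lists (K 6) L →
                              Σ (Colouring (K 6)) λ col → FromLists (K 6) L col × GoodColouring col
  good-colouring-from-lists L valid = col , from-lists , relabel-good (κ-good M∈ M-varies light) τ τ-injective
    where
    Lˢ : Fin 6 → Fin 6 → ℕ × ℕ
    Lˢ = symmetrise L
    open Selection Lˢ (symmetrise-sym L) (symmetrise-proper L valid)
    open ColouringPlan plan
    L′ : Fin 6 → Fin 6 → ℕ × ℕ
    L′ x y = Lˢ (relabel k x) (relabel k y)
    open PartColouring L′ (λ x y → symmetrise-sym L _ _)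
                          (λ x y x≢y → symmetrise-proper L valid _ _ (x≢y ∘ relabel-injective k)) M
    π : Permutation 6 6
    π = injective⇒permutation (relabel k) (relabel-injective k)
    τ : Fin 6 → Fin 6
    τ = π ⟨$⟩ˡ_
    τ-injective : Injective _≡_ _≡_ τ
    τ-injective {x} {y} τx≡τy = trans (sym (inverseʳ π)) (trans (cong (relabel k) τx≡τy) (inverseʳ π))
    col : Colouring (K 6)
    col x y = κ (τ x) (τ y)
    light : ∀ c → (∀ i → M i ≢ c) → occurrences L′ c ≤ 10
    light c unused = subst (_≤ 10) (sym (occurrences-permute Lˢ (symmetrise-sym L) π c))
                           (ℕ.≮⇒≥ λ heavy → let (i , Mi≡c) = heavy-used c heavy in unused i Mi≡c)
    from-lists : FromLists (K 6) L col
    from-lists x y (_ , x<y) = subst (col x y ∈₂_) (trans (cong₂ Lˢ (inverseʳ π) (inverseʳ π)) (symmetrise-< L x<y))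
                                     (κ-∈ M∈ (τ x) (τ y) ((ℕ.<⇒≢ x<y ∘ cong toℕ) ∘ τ-injective))

mainTheorem18 : (𝓕 : Family) → M2FamilyAtLeast 𝓕 ((+ 5) / 2) → ¬ Is2ListRamsey (K 6) 𝓕
mainTheorem18 𝓕 dense (L , valid , ramsey) with good-colouring-from-lists L valid
... | col , from-lists , good = good⇒no-dense-copy good 𝓕 dense (ramsey col from-lists)
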